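{- Let $k$ be a positive integer and $N_k$ a number such that for every prime $p_m \geq N_k$ one has $\sqrt{p_m} - \sqrt{p_{m-1}} < \frac{1}{k}$. Then for every integer $n > N_k$ the open interval $(n, 2n)$ contains at least $\left[\frac{k}{4}\sqrt{2n}\right]$ prime numbers.
   Context: $p_m$ denotes the $m$-th prime number ($p_1 = 2$), so $p_{m-1}$ is the prime immediately preceding $p_m$. $[x]$ denotes the integer part (floor) of $x$. -}

module Defs where

open import Data.Nat using (ℕ; suc; _+_; _*_; _∸_; _^_; _≤_; _<_)
open import Data.Nat.Primality using (Prime; prime?)
open import Data.List using (List; length; filter; map; upTo)
open import Relation.Nullary using (¬_)
open import Data.Product using (_×_)

ConsecutivePrimes : ℕ → ℕ → Set
ConsecutivePrimes q p = Prime q × Prime p × q < p × (∀ r → q < r → r < p → ¬ Prime r)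

-- For consecutive primes q < p and k ≥ 1:
--   √p − √q < 1/k  ⇔  k²(p − q) − 1 < 2k√q  ⇔  (k²(p − q) − 1)² < 4k²q
-- (the left side k²(p−q)−1 is ≥ 0 since p > q and k ≥ 1, so squaring is valid).
SqrtGapLt : (k q p : ℕ) → Set
SqrtGapLt k q p = (k * k * (p ∸ q) ∸ 1) ^ 2 < 4 * (k * k) * q

openInterval : ℕ → List ℕ
openInterval n = map (λ i → suc n + i) (upTo (n ∸ 1))

primesBetween : ℕ → ℕ
primesBetween n = length (filter prime? (openInterval n))

-- [ (k/4) √(2n) ] ≤ c, written without reals:
-- every natural m with m ≤ (k/4)√(2n), i.e. 16 m² ≤ 2 n k², satisfies m ≤ c.
FloorKQuarterSqrt2nLe : (k n c : ℕ) → Set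
FloorKQuarterSqrt2nLe k n c = ∀ m → 16 * (m * m) ≤ 2 * n * (k * k) → m ≤ c

-- If q < p are consecutive primes with p ≥ N, then k√p < k√q + 1. So an integer T with
-- 8k√q < T for the greatest prime q below x stays an upper bound, up to adding 8 per prime, as x
-- moves to the right. Starting with T = ⌊8k√n⌋ + 1 at x = n + 1 and passing the c primes of
-- (n, 2n) and then the least prime p ≥ 2n gives 8k√(2n) ≤ 8k√p < ⌊8k√n⌋ + 1 + 8(c + 1).
-- If c < m for some m ≤ (k/4)√(2n), the right side is at most 8k√n + 1 + 8m, and this is
-- below 8k√(2n) because 8 ≤ 8m ≤ 2k√(2n).
module Submission where

open import Data.Nat
open import Data.Nat.Properties
open import Data.Nat.Divisibility using (_∣_; ∣-trans; m∣m*n; ∣m+n∣m⇒∣n; ∣1⇒≡1; m≤n⇒m!∣n!)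
open import Data.Nat.Primality
open import Data.Nat.Primality.Factorisation using (factorise)
open import Data.Nat.ListAction using (product)
open import Data.Nat.Tactic.RingSolver using (solve-∀)
open import Data.List using (List; []; _∷_; length; filter; applyUpTo)
open import Data.List.Properties using (map-upTo)
open import Data.List.Relation.Unary.All using (_∷_)
open import Data.Product using (∃; ∃-syntax; _×_; _,_; map₂)
open import Data.Sum using (inj₁; inj₂)
open import Relation.Nullary using (¬_; yes; no; contradiction)
open import Relation.Nullary.Decidable using (from-yes)
open import Relation.Binary.PropositionalEquality
open import Defs

m+o≡n⇒m≤n : ∀ {m n} o → m + o ≡ n → m ≤ n
m+o≡n⇒m≤n {m} o refl = m≤m+n m o

m*m<n*n⇒m<n : ∀ {m n} → m * m < n * n → m < n
m*m<n*n⇒m<n m*m<n*n = ≰⇒> λ n≤m → <⇒≱ m*m<n*n (*-mono-≤ n≤m n≤m)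

2*m*n≤m*m+n*n-ordered : ∀ {m n} → m ≤ n → 2 * (m * n) ≤ m * m + n * n
2*m*n≤m*m+n*n-ordered {m} m≤n with m≤n⇒∃[o]m+o≡n m≤n
... | d , refl = m+o≡n⇒m≤n (d * d) (identity m d)
  where
  identity : ∀ m d → 2 * (m * (m + d)) + d * d ≡ m * m + (m + d) * (m + d)
  identity = solve-∀

2*m*n≤m*m+n*n : ∀ m n → 2 * (m * n) ≤ m * m + n * n
2*m*n≤m*m+n*n m n with ≤-total m n
... | inj₁ m≤n = 2*m*n≤m*m+n*n-ordered m≤n
... | inj₂ n≤m = subst₂ _≤_ (cong (2 *_) (*-comm n m)) (+-comm (n * n) (m * m))
                   (2*m*n≤m*m+n*n-ordered n≤m)

-- The difference of the two sides is (m − 2n)².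
2*[m+n]²≤3*m²+6*n² : ∀ m n → 2 * ((m + n) * (m + n)) ≤ 3 * (m * m) + 6 * (n * n)
2*[m+n]²≤3*m²+6*n² m n = begin
  2 * ((m + n) * (m + n))                          ≡⟨ expand m n ⟩
  2 * (m * m) + 2 * (n * n) + 2 * (m * (2 * n))  
      ≤⟨ +-monoʳ-≤ (2 * (m * m) + 2 * (n * n)) (2*m*n≤m*m+n*n m (2 * n)) ⟩
  2 * (m * m) + 2 * (n * n) + (m * m + 2 * n * (2 * n)) ≡⟨ collect m n ⟩
  3 * (m * m) + 6 * (n * n)                        ∎
  where
  open ≤-Reasoning
  expand : ∀ m n → 2 * ((m + n) * (m + n)) ≡ 2 * (m * m) + 2 * (n * n) + 2 * (m * (2 * n))
  expand = solve-∀
  collect : ∀ m n → 2 * (m * m) + 2 * (n * n) + (m * m + 2 * n * (2 * n)) ≡ 3 * (m * m) + 6 * (n * n)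
  collect = solve-∀

6*[1+8m]²≤512*m² : ∀ {m} → 1 ≤ m → 6 * (suc (8 * m) * suc (8 * m)) ≤ 512 * (m * m)
6*[1+8m]²≤512*m² {suc m} _ = m+o≡n⇒m≤n (26 + 160 * m + 128 * (m * m)) (identity m)
  where
  identity : ∀ m → 6 * (suc (8 * suc m) * suc (8 * suc m)) + (26 + 160 * m + 128 * (m * m))
                   ≡ 512 * (suc m * suc m)
  identity = solve-∀

[1+y+8m]²≤2*Z : ∀ y m {Z} → y * y ≤ Z → 512 * (m * m) ≤ Z → 1 ≤ m →
                (suc y + 8 * m) * (suc y + 8 * m) ≤ 2 * Z
[1+y+8m]²≤2*Z y m {Z} y²≤Z 512m²≤Z 1≤m = *-cancelˡ-≤ 2 (begin
  2 * ((suc y + 8 * m) * (suc y + 8 * m)) ≡⟨ cong (λ t → 2 * (t * t)) (+-suc y (8 * m)) ⟨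
  2 * ((y + u) * (y + u))                 ≤⟨ 2*[m+n]²≤3*m²+6*n² y u ⟩
  3 * (y * y) + 6 * (u * u)               ≤⟨ +-mono-≤ (*-monoʳ-≤ 3 y²≤Z) (6*[1+8m]²≤512*m² 1≤m) ⟩
  3 * Z + 512 * (m * m)                   ≤⟨ +-monoʳ-≤ (3 * Z) 512m²≤Z ⟩
  3 * Z + Z                               ≡⟨ collect Z ⟩
  2 * (2 * Z)                             ∎)
  where
  open ≤-Reasoning
  u : ℕ
  u = suc (8 * m)
  collect : ∀ Z → 3 * Z + Z ≡ 2 * (2 * Z)
  collect = solve-∀

-- For K = k², the hypothesis says √p − √q < 1/k; scaled by 8k it says that T > 8k√q
-- implies T + 8 > 8k√p.
sqrtGap⇒bound+8 : ∀ K q p T → (K * (p ∸ q) ∸ 1) ^ 2 < 4 * K * q →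
                  64 * (K * q) < T * T → 64 * (K * p) < (T + 8) * (T + 8)
sqrtGap⇒bound+8 K q p T gap 64Kq<T² = begin-strict
  64 * (K * p)                     ≤⟨ *-monoʳ-≤ 64 Kp≤Kq+1+e ⟩
  64 * (K * q + suc e)             ≡⟨ expand (K * q) e ⟩
  64 * (K * q) + 64 + 16 * (4 * e) <⟨ +-mono-<-≤ (+-monoˡ-< 64 64Kq<T²) (*-monoʳ-≤ 16 (<⇒≤ 4e<T)) ⟩
  T * T + 64 + 16 * T              ≡⟨ square T ⟩
  (T + 8) * (T + 8)                ∎
  where
  open ≤-Reasoning
  e : ℕ
  e = K * (p ∸ q) ∸ 1

  Kp≤Kq+1+e : K * p ≤ K * q + suc e
  Kp≤Kq+1+e = begin
    K * p                   ≤⟨ m≤n+m∸n (K * p) (K * q) ⟩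
    K * q + (K * p ∸ K * q) ≡⟨ cong (K * q +_) (*-distribˡ-∸ K p q) ⟨
    K * q + K * (p ∸ q)     ≤⟨ +-monoʳ-≤ (K * q) (m≤n+m∸n (K * (p ∸ q)) 1) ⟩
    K * q + suc e           ∎

  scale : ∀ e → 4 * e * (4 * e) ≡ 16 * (e * (e * 1))
  scale = solve-∀
  regroup : ∀ K q → 16 * (4 * K * q) ≡ 64 * (K * q)
  regroup = solve-∀

  4e<T : 4 * e < T
  4e<T = m*m<n*n⇒m<n (begin-strict
    4 * e * (4 * e)  ≡⟨ scale e ⟩
    16 * e ^ 2       <⟨ *-monoʳ-< 16 gap ⟩
    16 * (4 * K * q) ≡⟨ regroup K q ⟩
    64 * (K * q)     <⟨ 64Kq<T² ⟩
    T * T            ∎)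

  expand : ∀ a e → 64 * (a + suc e) ≡ 64 * a + 64 + 16 * (4 * e)
  expand = solve-∀
  square : ∀ T → T * T + 64 + 16 * T ≡ (T + 8) * (T + 8)
  square = solve-∀

16*m²≤2*n*K⇒512*m²≤64*[K*n] : ∀ m n K → 16 * (m * m) ≤ 2 * n * K → 512 * (m * m) ≤ 64 * (K * n)
16*m²≤2*n*K⇒512*m²≤64*[K*n] m n K 16m²≤2nK = begin
  512 * (m * m)       ≡⟨ *-assoc 32 16 (m * m) ⟩
  32 * (16 * (m * m)) ≤⟨ *-monoʳ-≤ 32 16m²≤2nK ⟩
  32 * (2 * n * K)    ≡⟨ regroup n K ⟩
  64 * (K * n)        ∎
  where
  open ≤-Reasoning
  regroup : ∀ n K → 32 * (2 * n * K) ≡ 64 * (K * n)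
  regroup = solve-∀

m≤n⇒m∣n! : ∀ {m n} .{{_ : NonZero m}} → m ≤ n → m ∣ n !
m≤n⇒m∣n! {suc m} m≤n = ∣-trans (m∣m*n (m !)) (m≤n⇒m!∣n! m≤n)

∃-prime-divisor : ∀ n .{{_ : NonTrivial n}} → ∃[ p ] (Prime p × p ∣ n)
∃-prime-divisor n with factorise n {{nonTrivial⇒nonZero n}}
... | record { factors = [] ; isFactorisation = n≡1 } = contradiction n≡1 nonTrivial⇒≢1
... | record { factors = p ∷ ps ; isFactorisation = refl ; factorsPrime = prime-p ∷ _ } =
  p , prime-p , m∣m*n (product ps)

-- Euclid: a prime divisor of x! + 1 cannot be at most x.
∃-prime-≥ : ∀ x → ∃[ p ] (Prime p × x ≤ p)
∃-prime-≥ x with ∃-prime-divisor (suc (x !)) {{n>1⇒nonTrivial (s≤s (1≤n! x))}}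
... | p , prime-p , p∣1+x! = p , prime-p , ≮⇒≥ λ p<x → ¬prime[1] (subst Prime (p≡1 (<⇒≤ p<x)) prime-p)
  where
  p≡1 : p ≤ x → p ≡ 1
  p≡1 p≤x = ∣1⇒≡1 (∣m+n∣m⇒∣n (subst (p ∣_) (+-comm 1 (x !)) p∣1+x!)
                              (m≤n⇒m∣n! {{prime⇒nonZero prime-p}} p≤x))

GreatestPrimeBelow : ℕ → ℕ → Set
GreatestPrimeBelow x q = Prime q × q < x × (∀ r → q < r → r < x → ¬ Prime r)

LeastPrimeFrom : ℕ → ℕ → Set
LeastPrimeFrom x p = Prime p × x ≤ p × (∀ r → x ≤ r → r < p → ¬ Prime r)

greatestPrimeBelow∧leastPrimeFrom⇒consecutive : ∀ {x q p} →
  GreatestPrimeBelow x q → LeastPrimeFrom x p → ConsecutivePrimes q p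
greatestPrimeBelow∧leastPrimeFrom⇒consecutive {x} (prime-q , q<x , q-greatest) (prime-p , x≤p , p-least) =
  prime-q , prime-p , <-≤-trans q<x x≤p , no-prime-between
  where
  no-prime-between : ∀ r → _ < r → r < _ → ¬ Prime r
  no-prime-between r q<r r<p with r <? x
  ... | yes r<x = q-greatest r q<r r<x
  ... | no r≮x  = p-least r (≮⇒≥ r≮x) r<p

prime⇒greatestPrimeBelow-suc : ∀ {x} → Prime x → GreatestPrimeBelow (suc x) x
prime⇒greatestPrimeBelow-suc prime-x =
  prime-x , n<1+n _ , λ r x<r r<1+x → contradiction (s≤s⁻¹ r<1+x) (<⇒≱ x<r)

¬prime⇒greatestPrimeBelow-suc : ∀ {x q} → ¬ Prime x → GreatestPrimeBelow x q → GreatestPrimeBelow (suc x) q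
¬prime⇒greatestPrimeBelow-suc {x} ¬prime-x (prime-q , q<x , q-greatest) =
  prime-q , m≤n⇒m≤1+n q<x , no-prime-between
  where
  no-prime-between : ∀ r → _ < r → r < suc x → ¬ Prime r
  no-prime-between r q<r r<1+x with m<1+n⇒m<n∨m≡n r<1+x
  ... | inj₁ r<x  = q-greatest r q<r r<x
  ... | inj₂ refl = ¬prime-x

∃-greatestPrimeBelow : ∀ x → ∃ (GreatestPrimeBelow (3 + x))
∃-greatestPrimeBelow zero = 2 , prime⇒greatestPrimeBelow-suc prime[2]
∃-greatestPrimeBelow (suc x) with ∃-greatestPrimeBelow x | prime? (3 + x)
... | _ , _ | yes prime-3+x = 3 + x , prime⇒greatestPrimeBelow-suc prime-3+x
... | q , q-greatest | no ¬prime-3+x = q , ¬prime⇒greatestPrimeBelow-suc ¬prime-3+x q-greatest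

prime⇒leastPrimeFrom : ∀ {x} → Prime x → LeastPrimeFrom x x
prime⇒leastPrimeFrom prime-x = prime-x , ≤-refl , λ r x≤r r<x → contradiction x≤r (<⇒≱ r<x)

¬prime⇒leastPrimeFrom-pred : ∀ {x p} → ¬ Prime x → LeastPrimeFrom (suc x) p → LeastPrimeFrom x p
¬prime⇒leastPrimeFrom-pred {x} ¬prime-x (prime-p , x<p , p-least) =
  prime-p , <⇒≤ x<p , no-prime-before
  where
  no-prime-before : ∀ r → x ≤ r → r < _ → ¬ Prime r
  no-prime-before r x≤r r<p with m≤n⇒m<n∨m≡n x≤r
  ... | inj₁ x<r  = p-least r x<r r<p
  ... | inj₂ refl = ¬prime-x

prime[d+x]⇒∃-leastPrimeFrom : ∀ d {x} → Prime (d + x) → ∃ (LeastPrimeFrom x)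
prime[d+x]⇒∃-leastPrimeFrom d {x} prime-d+x with prime? x
... | yes prime-x = x , prime⇒leastPrimeFrom prime-x
prime[d+x]⇒∃-leastPrimeFrom zero    prime-x | no ¬prime-x = contradiction prime-x ¬prime-x
prime[d+x]⇒∃-leastPrimeFrom (suc d) {x} prime-1+d+x | no ¬prime-x =
  map₂ (¬prime⇒leastPrimeFrom-pred ¬prime-x)
    (prime[d+x]⇒∃-leastPrimeFrom d (subst Prime (sym (+-suc d x)) prime-1+d+x))

∃-leastPrimeFrom : ∀ x → ∃ (LeastPrimeFrom x)
∃-leastPrimeFrom x with ∃-prime-≥ x
... | p , prime-p , x≤p = prime[d+x]⇒∃-leastPrimeFrom (p ∸ x) (subst Prime (sym (m∸n+n≡m x≤p)) prime-p)

primeCount : List ℕ → ℕ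
primeCount xs = length (filter prime? xs)

range : ℕ → ℕ → List ℕ
range a zero    = []
range a (suc j) = a ∷ range (suc a) j

applyUpTo-+≡range : ∀ j {a} (f : ℕ → ℕ) → (∀ i → f i ≡ a + i) → applyUpTo f j ≡ range a j
applyUpTo-+≡range zero    f f≗a+ = refl
applyUpTo-+≡range (suc j) {a} f f≗a+ =
  cong₂ _∷_ (trans (f≗a+ 0) (+-identityʳ a))
            (applyUpTo-+≡range j (λ i → f (suc i)) (λ i → trans (f≗a+ (suc i)) (+-suc a i)))

openInterval≡range : ∀ n → openInterval n ≡ range (suc n) (n ∸ 1)
openInterval≡range n =
  trans (map-upTo (suc n +_) (n ∸ 1)) (applyUpTo-+≡range (n ∸ 1) (suc n +_) (λ _ → refl))

∃-isqrt : ∀ Z → ∃[ b ] (b * b ≤ Z × Z < suc b * suc b)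
∃-isqrt zero = 0 , z≤n , s≤s z≤n
∃-isqrt (suc Z) with ∃-isqrt Z
... | b , b²≤Z , Z<[1+b]² with suc Z <? suc b * suc b
...   | yes 1+Z<[1+b]² = b , m≤n⇒m≤1+n b²≤Z , 1+Z<[1+b]²
...   | no  1+Z≮[1+b]² = suc b , ≮⇒≥ 1+Z≮[1+b]² ,
                         ≤-<-trans Z<[1+b]² (*-mono-< (n<1+n (suc b)) (n<1+n (suc b)))

module SqrtGapBound {k N : ℕ} (sqrtGap : ∀ q p → ConsecutivePrimes q p → N ≤ p → SqrtGapLt k q p) where

  -- 8k√q < T for the greatest prime q below x.
  Bound : ℕ → ℕ → Set
  Bound x T = ∃[ q ] (GreatestPrimeBelow x q × 64 * (k * k * q) < T * T)

  bound⇒leastPrimeFrom-bound : ∀ {x T p} → N ≤ p → Bound x T → LeastPrimeFrom x p →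
                               64 * (k * k * p) < (T + 8) * (T + 8)
  bound⇒leastPrimeFrom-bound {T = T} {p} N≤p (q , q-greatest , 64k²q<T²) p-least =
    sqrtGap⇒bound+8 (k * k) q p T
      (sqrtGap q p (greatestPrimeBelow∧leastPrimeFrom⇒consecutive q-greatest p-least) N≤p) 64k²q<T²

  prime⇒bound-suc : ∀ {x T} → N ≤ x → Prime x → Bound x T → Bound (suc x) (T + 8)
  prime⇒bound-suc {x} {T} N≤x prime-x bound =
    x , prime⇒greatestPrimeBelow-suc prime-x ,
    bound⇒leastPrimeFrom-bound {T = T} N≤x bound (prime⇒leastPrimeFrom prime-x)

  ¬prime⇒bound-suc : ∀ {x T} → ¬ Prime x → Bound x T → Bound (suc x) T
  ¬prime⇒bound-suc ¬prime-x (q , q-greatest , 64k²q<T²) =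
    q , ¬prime⇒greatestPrimeBelow-suc ¬prime-x q-greatest , 64k²q<T²

  bound-range : ∀ j {x T} → N ≤ x → Bound x T → Bound (j + x) (T + 8 * primeCount (range x j))
  bound-range zero {x} {T} _ bound = subst (Bound x) (sym (+-identityʳ T)) bound
  bound-range (suc j) {x} {T} N≤x bound with prime? x
  ... | yes prime-x = subst₂ Bound (+-suc j x)
                        (trans (+-assoc T 8 (8 * c)) (cong (T +_) (sym (*-suc 8 c))))
                        (bound-range j {T = T + 8} (m≤n⇒m≤1+n N≤x) (prime⇒bound-suc {T = T} N≤x prime-x bound))
    where
    c : ℕ
    c = primeCount (range (suc x) j)
  ... | no ¬prime-x = subst (λ y → Bound y (T + 8 * primeCount (range (suc x) j))) (+-suc j x)
                        (bound-range j {T = T} (m≤n⇒m≤1+n N≤x) (¬prime⇒bound-suc {T = T} ¬prime-x bound))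

  bound-beyond-2n : ∀ {n T} → N < 2 + n → 64 * (k * k * (2 + n)) < T * T →
                    let T′ = T + 8 * suc (primesBetween (2 + n))
                    in  2 * (64 * (k * k * (2 + n))) < T′ * T′
  bound-beyond-2n {n} {T} N<2+n 64k²n<T² with ∃-greatestPrimeBelow n
  ... | q , q-greatest@(_ , q<3+n , _) with ∃-leastPrimeFrom (2 * (2 + n))
  ... | p , p-least@(_ , 2n≤p , _) = begin-strict
    2 * (64 * (k * k * (2 + n)))     ≡⟨ regroup (k * k) (2 + n) ⟩
    64 * (k * k * (2 * (2 + n)))     ≤⟨ *-monoʳ-≤ 64 (*-monoʳ-≤ (k * k) 2n≤p) ⟩
    64 * (k * k * p)                 <⟨ bound⇒leastPrimeFrom-bound {T = T + 8 * c} N≤p scanned p-least ⟩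
    (T + 8 * c + 8) * (T + 8 * c + 8) ≡⟨ cong (λ t → t * t) (shift T c) ⟩
    (T + 8 * suc c) * (T + 8 * suc c) ∎
    where
    open ≤-Reasoning
    c : ℕ
    c = primesBetween (2 + n)

    regroup : ∀ K n → 2 * (64 * (K * n)) ≡ 64 * (K * (2 * n))
    regroup = solve-∀
    shift : ∀ T c → T + 8 * c + 8 ≡ T + 8 * suc c
    shift = solve-∀
    end-of-interval : ∀ n → (1 + n) + (3 + n) ≡ 2 * (2 + n)
    end-of-interval = solve-∀

    N≤p : N ≤ p
    N≤p = ≤-trans (<⇒≤ N<2+n) (≤-trans (m≤m+n (2 + n) (1 * (2 + n))) 2n≤p)

    initial : Bound (3 + n) T
    initial = q , q-greatest , ≤-<-trans (*-monoʳ-≤ 64 (*-monoʳ-≤ (k * k) (s≤s⁻¹ q<3+n))) 64k²n<T²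

    scanned : Bound (2 * (2 + n)) (T + 8 * c)
    scanned = subst₂ Bound (end-of-interval n)
                (cong (λ xs → T + 8 * primeCount xs) (sym (openInterval≡range (2 + n))))
                (bound-range (1 + n) {T = T} (m≤n⇒m≤1+n (<⇒≤ N<2+n)) initial)

consecutivePrimes-3-5 : ConsecutivePrimes 3 5
consecutivePrimes-3-5 = from-yes (prime? 3) , from-yes (prime? 5) , m≤n⇒m≤1+n ≤-refl , only-4-between
  where
  only-4-between : ∀ r → 3 < r → r < 5 → ¬ Prime r
  only-4-between r 3<r r<5 with ≤-antisym (s≤s⁻¹ r<5) 3<r
  ... | refl = composite⇒¬prime composite[4]

¬sqrtGap-3-5 : ∀ K → 8 ≤ K → ¬ (K * 2 ∸ 1) ^ 2 < 4 * K * 3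
¬sqrtGap-3-5 K 8≤K with m≤n⇒∃[o]m+o≡n 8≤K
... | d , refl = ≤⇒≯ (m+o≡n⇒m≤n (129 + 48 * d + 4 * (d * d)) (identity d))
  where
  identity : ∀ d → 4 * (8 + d) * 3 + (129 + 48 * d + 4 * (d * d)) ≡ (15 + d * 2) * ((15 + d * 2) * 1)
  identity = solve-∀

-- For n = 1 no prime lies below n; instead the gap from 3 to 5 forces k² < 8, leaving only m = 0.
proposition1 : (k : ℕ) → .{{_ : NonZero k}} → (N : ℕ)
               → (∀ q p → ConsecutivePrimes q p → N ≤ p → SqrtGapLt k q p)
               → ∀ n → N < n → FloorKQuarterSqrt2nLe k n (primesBetween n)
proposition1 k N sqrtGap 1 (s≤s z≤n) zero    _ = z≤n
proposition1 k N sqrtGap 1 (s≤s z≤n) (suc m) 16m²≤2k² =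
  contradiction (sqrtGap 3 5 consecutivePrimes-3-5 z≤n) (¬sqrtGap-3-5 (k * k) 8≤k²)
  where
  8≤k² : 8 ≤ k * k
  8≤k² = *-cancelˡ-≤ 2 (≤-trans (*-monoʳ-≤ 16 (*-mono-≤ (s≤s (z≤n {m})) (s≤s (z≤n {m})))) 16m²≤2k²)
proposition1 k N sqrtGap n@(2+ _) N<n m 16m²≤2nk² with ∃-isqrt (64 * (k * k * n))
... | b , b²≤64k²n , 64k²n<[1+b]² =
  ≮⇒≥ λ c<m → <⇒≱ (bound-beyond-2n {T = suc b} N<n 64k²n<[1+b]²) (square-bound c<m)
  where
  open SqrtGapBound {k} sqrtGap
  open ≤-Reasoning
  c : ℕ
  c = primesBetween n

  square-bound : c < m → (suc b + 8 * suc c) * (suc b + 8 * suc c) ≤ 2 * (64 * (k * k * n))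
  square-bound c<m = begin
    (suc b + 8 * suc c) * (suc b + 8 * suc c) ≤⟨ *-mono-≤ T≤ T≤ ⟩
    (suc b + 8 * m) * (suc b + 8 * m)         ≤⟨ [1+y+8m]²≤2*Z b m b²≤64k²n 512m²≤64k²n (≤-trans (s≤s z≤n) c<m) ⟩
    2 * (64 * (k * k * n))                     ∎
    where
    T≤ : suc b + 8 * suc c ≤ suc b + 8 * m
    T≤ = +-monoʳ-≤ (suc b) (*-monoʳ-≤ 8 c<m)
    512m²≤64k²n : 512 * (m * m) ≤ 64 * (k * k * n)
    512m²≤64k²n = 16*m²≤2*n*K⇒512*m²≤64*[K*n] m n (k * k) 16m²≤2nk²
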